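{- Let $n\geq 1$, $n^*=\lceil n/2\rceil$, and let $C\subseteq A$ and $C\subseteq B$ be metric spaces with distances in $\{0,\ldots,n\}$ whose metrics agree on $C$. Then there is a metric space $D$ with distances in $\{0,\ldots,n\}$ and isometric embeddings $\iota_A:A\hookrightarrow D$, $\iota_B:B\hookrightarrow D$ with $\iota_A|_C=\iota_B|_C$, such that for all $a\in A\setminus C$, $b\in B\setminus C$, writing $d_{ab}=d_D(\iota_A(a),\iota_B(b))$, $m_{ab}=\min_{c\in C}(d_A(a,c)+d_B(b,c))$ and $m^{ab}=\max_{c\in C}|d_A(a,c)-d_B(b,c)|$: (a) $d_{ab}=m_{ab}$ if $m_{ab}<n^*$; (b) $d_{ab}=m^{ab}$ if $m^{ab}>n^*$; (c) $d_{ab}=n^*$ otherwise. -}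

module Defs where

open import Data.Nat using (ℕ; _+_; _≤_; _<_; ⌈_/2⌉; ∣_-_∣)
open import Data.Fin using (Fin)
open import Data.Product using (Σ; ∃; _×_)
open import Relation.Binary.PropositionalEquality using (_≡_; _≢_)
open import Relation.Nullary using (¬_)

record FinMetric (n : ℕ) : Set where
  field
    size  : ℕ
    d     : Fin size → Fin size → ℕ
    bound : ∀ x y → d x y ≤ n
    zero⇔ : ∀ x y → (d x y ≡ 0 → x ≡ y) × (x ≡ y → d x y ≡ 0)
    sym   : ∀ x y → d x y ≡ d y x
    tri   : ∀ x y z → d x z ≤ d x y + d y z

open FinMetric public

Pt : ∀ {n} → FinMetric n → Set
Pt M = Fin (size M)

-- isometric embedding (isometries are automatically injective on metric spaces)
IsIsometry : ∀ {n} (M N : FinMetric n) → (Pt M → Pt N) → Set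
IsIsometry M N f = ∀ x y → d N (f x) (f y) ≡ d M x y

IsMinOf : ∀ {k} → (Fin k → ℕ) → ℕ → Set
IsMinOf f m = (∃ λ c → f c ≡ m) × (∀ c → m ≤ f c)

IsMaxOf : ∀ {k} → (Fin k → ℕ) → ℕ → Set
IsMaxOf f m = (∃ λ c → f c ≡ m) × (∀ c → f c ≤ m)

-- the conclusion (a),(b),(c) for a single pair a ∈ A∖C, b ∈ B∖C
-- sumC c = d_A(a,c) + d_B(b,c),  difC c = |d_A(a,c) - d_B(b,c)|
Rule : ∀ {k} (n dab : ℕ) (sumC difC : Fin k → ℕ) → Set
Rule n dab sumC difC =
  (∀ m → IsMinOf sumC m → m < ⌈ n /2⌉ → dab ≡ m) ×
  (∀ M → IsMaxOf difC M → ⌈ n /2⌉ < M → dab ≡ M) ×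
  (¬ (∃ λ m → IsMinOf sumC m × m < ⌈ n /2⌉) →
   ¬ (∃ λ M → IsMaxOf difC M × ⌈ n /2⌉ < M) →
   dab ≡ ⌈ n /2⌉)

-- Glue A and B along C: the distance of a cross pair (a , b) is n* clamped into the interval
-- [m^ab , m_ab], which is nonempty because C sits isometrically in both spaces. A clamped value
-- above n* equals some |d_A(a,c) - d_B(b,c)| and one below n* equals some d_A(a,c) + d_B(b,c),
-- so every mixed triangle closes by a triangle inequality through that c, or else by n ≤ 2 n*.
-- Identifying the points at distance 0 of the resulting pseudometric on A ⊎ B (the two copies
-- of C) gives D.
module Submission where

open import Defs
open import Data.Nat using (ℕ; _≤_; _+_; ∣_-_∣)
open import Data.Product using (Σ; _×_)
open import Relation.Binary.PropositionalEquality using (_≡_; _≢_)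
open import Data.Nat as ℕ using (_<_; ⌈_/2⌉; _≟_)
open import Data.Nat.Properties
open import Data.Fin using (Fin; zero; suc)
open import Data.Fin.Properties using (any?; +↔⊎)
open import Data.Product using (∃; _,_; proj₁; proj₂)
open import Data.Sum using (_⊎_; inj₁; inj₂; [_,_]′; map₂)
open import Data.List.Base using (List; tabulate)
open import Data.List.Extrema.Nat
  using (min; max; min≤⊤; min≤xs; argmin-sel; xs≤max; max≤v⁺; v≤max⁺; argmax-sel)
import Data.List.Relation.Unary.All.Properties as All
import Data.List.Relation.Unary.Any.Properties as Any
open import Data.Empty using (⊥-elim)
open import Function.Base using (id; _∘_; _on_)
open import Function.Bundles using (_↔_; Inverse)
open import Relation.Nullary using (¬_; yes; no; contradiction)
open import Relation.Binary.PropositionalEquality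
  using (refl; trans; cong; cong₂; subst; module ≡-Reasoning)
import Relation.Binary.PropositionalEquality as ≡
open import Relation.Binary.Definitions using (tri<; tri≈; tri>)

m≤n+o∧n≤m+o⇒∣m-n∣≤o : ∀ {m n o} → m ≤ n + o → n ≤ m + o → ∣ m - n ∣ ≤ o
m≤n+o∧n≤m+o⇒∣m-n∣≤o {m} {n} m≤n+o n≤m+o with ∣m-n∣≡[m∸n]∨[n∸m] m n
... | inj₁ eq = subst (_≤ _) (≡.sym eq) (m≤n+o⇒m∸n≤o m n m≤n+o)
... | inj₂ eq = subst (_≤ _) (≡.sym eq) (m≤n+o⇒m∸n≤o n m n≤m+o)

n≤⌈n/2⌉+⌈n/2⌉ : ∀ n → n ≤ ⌈ n /2⌉ + ⌈ n /2⌉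
n≤⌈n/2⌉+⌈n/2⌉ n = subst (_≤ ⌈ n /2⌉ + ⌈ n /2⌉) (⌊n/2⌋+⌈n/2⌉≡n n)
  (+-monoˡ-≤ ⌈ n /2⌉ (⌊n/2⌋≤⌈n/2⌉ n))

record IsPseudometric {X : Set} (ρ : X → X → ℕ) : Set where
  field
    self≡0    : ∀ x → ρ x x ≡ 0
    symmetric : ∀ x y → ρ x y ≡ ρ y x
    triangle  : ∀ x y z → ρ x z ≤ ρ x y + ρ y z

  cong₀ˡ : ∀ {u u'} v → ρ u u' ≡ 0 → ρ u v ≡ ρ u' v
  cong₀ˡ {u} {u'} v uu'≡0 = ≤-antisym
    (begin
      ρ u v            ≤⟨ triangle u u' v ⟩
      ρ u u' + ρ u' v  ≡⟨ cong (_+ ρ u' v) uu'≡0 ⟩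
      ρ u' v           ∎)
    (begin
      ρ u' v           ≤⟨ triangle u' u v ⟩
      ρ u' u + ρ u v   ≡⟨ cong (_+ ρ u v) (trans (symmetric u' u) uu'≡0) ⟩
      ρ u v            ∎)
    where open ≤-Reasoning

  cong₀ : ∀ {u u' v v'} → ρ u u' ≡ 0 → ρ v v' ≡ 0 → ρ u v ≡ ρ u' v'
  cong₀ {u} {u'} {v} {v'} uu'≡0 vv'≡0 = begin
    ρ u v    ≡⟨ cong₀ˡ v uu'≡0 ⟩
    ρ u' v   ≡⟨ symmetric u' v ⟩
    ρ v u'   ≡⟨ cong₀ˡ u' vv'≡0 ⟩
    ρ v' u'  ≡⟨ symmetric v' u' ⟩
    ρ u' v'  ∎
    where open ≡-Reasoning

isPseudometric-on : ∀ {X Y : Set} {ρ : Y → Y → ℕ} (f : X → Y) →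
  IsPseudometric ρ → IsPseudometric (ρ on f)
isPseudometric-on f isρ = record
  { self≡0    = λ x → self≡0 (f x)
  ; symmetric = λ x y → symmetric (f x) (f y)
  ; triangle  = λ x y z → triangle (f x) (f y) (f z)
  }
  where open IsPseudometric isρ

record Transversal {N} (ρ : Fin N → Fin N → ℕ) : Set where
  field
    classes       : ℕ
    rep           : Fin classes → Fin N
    classOf       : Fin N → Fin classes
    rep-classOf   : ∀ x → ρ (rep (classOf x)) x ≡ 0
    rep-separated : ∀ p q → ρ (rep p) (rep q) ≡ 0 → p ≡ q

transversal : ∀ {N} {ρ : Fin N → Fin N → ℕ} → IsPseudometric ρ → Transversal ρ
transversal {ℕ.zero} _ = record
  { classes = 0 ; rep = λ () ; classOf = λ () ; rep-classOf = λ () ; rep-separated = λ () }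
transversal {ℕ.suc N} {ρ} isρ
  with transversal (isPseudometric-on suc isρ) | any? (λ y → ρ zero (suc y) ≟ 0)
... | T | yes (y , 0~y) = record
  { classes       = classes
  ; rep           = suc ∘ rep
  ; classOf       = classOf⁺
  ; rep-classOf   = rep-classOf⁺
  ; rep-separated = rep-separated
  }
  where
  open Transversal T
  open IsPseudometric isρ
  classOf⁺ : Fin (ℕ.suc N) → Fin classes
  classOf⁺ zero    = classOf y
  classOf⁺ (suc x) = classOf x
  rep-classOf⁺ : ∀ x → ρ (suc (rep (classOf⁺ x))) x ≡ 0
  rep-classOf⁺ zero    = trans (cong₀ (self≡0 _) 0~y) (rep-classOf y)
  rep-classOf⁺ (suc x) = rep-classOf x
... | T | no 0≁ = record
  { classes       = ℕ.suc classes
  ; rep           = rep⁺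
  ; classOf       = classOf⁺
  ; rep-classOf   = rep-classOf⁺
  ; rep-separated = rep⁺-separated
  }
  where
  open Transversal T
  open IsPseudometric isρ
  rep⁺ : Fin (ℕ.suc classes) → Fin (ℕ.suc N)
  rep⁺ zero    = zero
  rep⁺ (suc p) = suc (rep p)
  classOf⁺ : Fin (ℕ.suc N) → Fin (ℕ.suc classes)
  classOf⁺ zero    = zero
  classOf⁺ (suc x) = suc (classOf x)
  rep-classOf⁺ : ∀ x → ρ (rep⁺ (classOf⁺ x)) x ≡ 0
  rep-classOf⁺ zero    = self≡0 zero
  rep-classOf⁺ (suc x) = rep-classOf x
  rep⁺-separated : ∀ p q → ρ (rep⁺ p) (rep⁺ q) ≡ 0 → p ≡ q
  rep⁺-separated zero    zero    _   = refl
  rep⁺-separated zero    (suc q) 0~q = contradiction (rep q , 0~q) 0≁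
  rep⁺-separated (suc p) zero    p~0 = contradiction (rep p , trans (symmetric _ _) p~0) 0≁
  rep⁺-separated (suc p) (suc q) p~q = cong suc (rep-separated p q p~q)

metricIdentification : ∀ {n N} {X : Set} {ρ : X → X → ℕ} →
  Fin N ↔ X → IsPseudometric ρ → (∀ x y → ρ x y ≤ n) →
  Σ (FinMetric n) λ D → Σ (X → Pt D) λ ι → ∀ x y → d D (ι x) (ι y) ≡ ρ x y
metricIdentification {n} {ρ = ρ} enum isρ ρ≤n = D , classOf ∘ from , ι-isometric
  where
  open Inverse enum
  open IsPseudometric (isPseudometric-on to isρ)
  open Transversal (transversal (isPseudometric-on to isρ))
  D : FinMetric n
  D = record
    { size  = classes
    ; d     = (ρ on to) on rep
    ; bound = λ p q → ρ≤n _ _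
    ; zero⇔ = λ p q → rep-separated p q , λ { refl → self≡0 _ }
    ; sym   = λ p q → symmetric _ _
    ; tri   = λ p q r → triangle _ _ _
    }
  ι-isometric : ∀ x y → d D (classOf (from x)) (classOf (from y)) ≡ ρ x y
  ι-isometric x y = trans (cong₀ (rep-classOf (from x)) (rep-classOf (from y)))
                          (cong₂ ρ (strictlyInverseˡ x) (strictlyInverseˡ y))

-- For the distance profiles x, y of a and b over C and t = n*: m^ab ≤ f ≤ m_ab, and f leaves t
-- only as far as these bounds force it to.
record Clamped {k} (t : ℕ) (x y : Fin k → ℕ) (f : ℕ) : Set where
  field
    diff≤   : ∀ c → ∣ x c - y c ∣ ≤ f
    ≤sum    : ∀ c → f ≤ x c + y c
    ≤t⊎diff : f ≤ t ⊎ ∃ λ c → f ≡ ∣ x c - y c ∣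
    t≤⊎sum  : t ≤ f ⊎ ∃ λ c → f ≡ x c + y c

open Clamped

clamp : ∀ {k} → ℕ → (x y : Fin k → ℕ) → ℕ
clamp t x y = max (min t (tabulate λ c → x c + y c)) (tabulate λ c → ∣ x c - y c ∣)

clamp-clamped : ∀ {k} t (x y : Fin k → ℕ) → (∀ c c' → ∣ x c - y c ∣ ≤ x c' + y c') →
  Clamped t x y (clamp t x y)
clamp-clamped t x y diff≤sum = record
  { diff≤   = All.tabulate⁻ (xs≤max lo diffs)
  ; ≤sum    = clamp≤sum
  ; ≤t⊎diff = [ (λ clamp≡lo → inj₁ (subst (_≤ t) (≡.sym clamp≡lo) (min≤⊤ t sums)))
              , (λ clamp∈diffs → inj₂ (Any.tabulate⁻ clamp∈diffs)) ]′
              (argmax-sel id lo diffs)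
  ; t≤⊎sum  = [ (λ lo≡t → inj₁ (subst (_≤ clamp t x y) lo≡t lo≤clamp))
              , (λ lo∈sums → let (c , lo≡sum) = Any.tabulate⁻ lo∈sums in
                  inj₂ (c , ≤-antisym (clamp≤sum c) (subst (_≤ clamp t x y) lo≡sum lo≤clamp))) ]′
              (argmin-sel id t sums)
  }
  where
  sums diffs : List ℕ
  sums  = tabulate λ c → x c + y c
  diffs = tabulate λ c → ∣ x c - y c ∣
  lo : ℕ
  lo = min t sums
  lo≤clamp : lo ≤ clamp t x y
  lo≤clamp = v≤max⁺ lo diffs (inj₁ ≤-refl)
  clamp≤sum : ∀ c → clamp t x y ≤ x c + y c
  clamp≤sum c = max≤v⁺ (All.tabulate⁻ (min≤xs t sums) c) (All.tabulate⁺ λ c' → diff≤sum c' c)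

clamped-swap : ∀ {k t} {x y : Fin k → ℕ} {f} → Clamped t x y f → Clamped t y x f
clamped-swap {x = x} {y} {f} cl = record
  { diff≤   = λ c → subst (_≤ _) (∣-∣-comm (x c) (y c)) (diff≤ cl c)
  ; ≤sum    = λ c → subst (f ≤_) (+-comm (x c) (y c)) (≤sum cl c)
  ; ≤t⊎diff = map₂ (λ (c , eq) → c , trans eq (∣-∣-comm (x c) (y c))) (≤t⊎diff cl)
  ; t≤⊎sum  = map₂ (λ (c , eq) → c , trans eq (+-comm (x c) (y c))) (t≤⊎sum cl)
  }

clamped⇒rule : ∀ {k n} {x y : Fin k → ℕ} {f} → Clamped ⌈ n /2⌉ x y f →
  Rule n f (λ c → x c + y c) (λ c → ∣ x c - y c ∣)
clamped⇒rule {n = n} {x} {y} {f} cl = below , above , between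
  where
  t = ⌈ n /2⌉
  below : ∀ m → IsMinOf (λ c → x c + y c) m → m < t → f ≡ m
  below m ((c , sum≡m) , m≤sum) m<t = ≤-antisym (subst (f ≤_) sum≡m (≤sum cl c))
    ([ (λ t≤f → <⇒≤ (<-≤-trans m<t t≤f))
     , (λ (c' , f≡sum) → subst (m ≤_) (≡.sym f≡sum) (m≤sum c')) ]′ (t≤⊎sum cl))
  above : ∀ M → IsMaxOf (λ c → ∣ x c - y c ∣) M → t < M → f ≡ M
  above M ((c , diff≡M) , diff≤M) t<M = ≤-antisym
    ([ (λ f≤t → <⇒≤ (≤-<-trans f≤t t<M))
     , (λ (c' , f≡diff) → subst (_≤ M) (≡.sym f≡diff) (diff≤M c')) ]′ (≤t⊎diff cl))
    (subst (_≤ f) diff≡M (diff≤ cl c))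
  between : ¬ (∃ λ m → IsMinOf (λ c → x c + y c) m × m < t) →
            ¬ (∃ λ M → IsMaxOf (λ c → ∣ x c - y c ∣) M × t < M) → f ≡ t
  between noMin noMax with <-cmp f t | t≤⊎sum cl | ≤t⊎diff cl
  ... | tri≈ _ f≡t _ | _ | _                  = f≡t
  ... | tri< f<t _ _ | inj₁ t≤f | _           = contradiction t≤f (<⇒≱ f<t)
  ... | tri< f<t _ _ | inj₂ (c , f≡sum) | _   =
    ⊥-elim (noMin (f , ((c , ≡.sym f≡sum) , ≤sum cl) , f<t))
  ... | tri> _ _ t<f | _ | inj₁ f≤t           = contradiction f≤t (<⇒≱ t<f)
  ... | tri> _ _ t<f | _ | inj₂ (c , f≡diff)  =
    ⊥-elim (noMax (f , ((c , ≡.sym f≡diff) , diff≤ cl) , t<f))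

δ≤sum+clamped : ∀ {k t} {x' y : Fin k → ℕ} {f' δ a} c →
  δ ≤ a + x' c → Clamped t x' y f' → δ ≤ a + y c + f'
δ≤sum+clamped {x' = x'} {y} {f'} {δ} {a} c δ≤a+x' cl' = begin
  δ                           ≤⟨ δ≤a+x' ⟩
  a + x' c                    ≤⟨ +-monoʳ-≤ a (m≤n+∣m-n∣ (x' c) (y c)) ⟩
  a + (y c + ∣ x' c - y c ∣)  ≤⟨ +-monoʳ-≤ a (+-monoʳ-≤ (y c) (diff≤ cl' c)) ⟩
  a + (y c + f')              ≡⟨ +-assoc a (y c) f' ⟨
  a + y c + f'                ∎
  where open ≤-Reasoning

module _ {k t} {x x' y : Fin k → ℕ} {f f'} (cl : Clamped t x y f) (cl' : Clamped t x' y f') where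

  clamped≤δ+clamped : ∀ {δ} → (∀ c → ∣ x c - x' c ∣ ≤ δ) → f ≤ δ + f'
  clamped≤δ+clamped {δ} x≈x' with ≤t⊎diff cl | t≤⊎sum cl'
  ... | inj₂ (c , f≡diff) | _ = begin
    f                                ≡⟨ f≡diff ⟩
    ∣ x c - y c ∣                    ≤⟨ ∣-∣-triangle (x c) (x' c) (y c) ⟩
    ∣ x c - x' c ∣ + ∣ x' c - y c ∣  ≤⟨ +-mono-≤ (x≈x' c) (diff≤ cl' c) ⟩
    δ + f'                           ∎
    where open ≤-Reasoning
  ... | inj₁ f≤t | inj₁ t≤f' = ≤-trans (≤-trans f≤t t≤f') (m≤n+m f' δ)
  ... | inj₁ _ | inj₂ (c , f'≡sum) = begin
    f                            ≤⟨ ≤sum cl c ⟩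
    x c + y c                    ≤⟨ +-monoˡ-≤ (y c) (m≤∣m-n∣+n (x c) (x' c)) ⟩
    ∣ x c - x' c ∣ + x' c + y c  ≤⟨ +-monoˡ-≤ (y c) (+-monoˡ-≤ (x' c) (x≈x' c)) ⟩
    δ + x' c + y c               ≡⟨ +-assoc δ (x' c) (y c) ⟩
    δ + (x' c + y c)             ≡⟨ cong (δ +_) (≡.sym f'≡sum) ⟩
    δ + f'                       ∎
    where open ≤-Reasoning

  δ≤clamped+clamped : ∀ {δ} → (∀ c → δ ≤ x c + x' c) → δ ≤ t + t → δ ≤ f + f'
  δ≤clamped+clamped {δ} δ≤x+x' δ≤2t with t≤⊎sum cl | t≤⊎sum cl'
  ... | inj₂ (c , f≡sum) | _ =
    subst (λ s → δ ≤ s + f') (≡.sym f≡sum) (δ≤sum+clamped c (δ≤x+x' c) cl')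
  ... | inj₁ _ | inj₂ (c , f'≡sum) =
    subst (δ ≤_) (trans (cong (_+ f) (≡.sym f'≡sum)) (+-comm f' f))
      (δ≤sum+clamped c (subst (δ ≤_) (+-comm (x c) (x' c)) (δ≤x+x' c)) cl)
  ... | inj₁ t≤f | inj₁ t≤f' = ≤-trans δ≤2t (+-mono-≤ t≤f t≤f')

∣d-d∣≤d : ∀ {n} (M : FinMetric n) p p' z → ∣ d M p z - d M p' z ∣ ≤ d M p p'
∣d-d∣≤d M p p' z = m≤n+o∧n≤m+o⇒∣m-n∣≤o
  (begin
    d M p z               ≤⟨ tri M p p' z ⟩
    d M p p' + d M p' z   ≡⟨ +-comm (d M p p') (d M p' z) ⟩
    d M p' z + d M p p'   ∎)
  (begin
    d M p' z              ≤⟨ tri M p' p z ⟩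
    d M p' p + d M p z    ≡⟨ cong (_+ d M p z) (sym M p' p) ⟩
    d M p p' + d M p z    ≡⟨ +-comm (d M p p') (d M p z) ⟩
    d M p z + d M p p'    ∎)
  where open ≤-Reasoning

d≤d+d : ∀ {n} (M : FinMetric n) p p' z → d M p p' ≤ d M p z + d M p' z
d≤d+d M p p' z = subst (λ s → d M p p' ≤ d M p z + s) (sym M z p') (tri M p z p')

module ClampedProfiles {n k} (M : FinMetric n) (e : Fin k → Pt M) {y : Fin k → ℕ}
  {f : Pt M → ℕ} (clamped : ∀ p → Clamped ⌈ n /2⌉ (λ c → d M p (e c)) y (f p)) where

  shiftˡ : ∀ p p' → f p ≤ d M p p' + f p'
  shiftˡ p p' = clamped≤δ+clamped (clamped p) (clamped p') λ c → ∣d-d∣≤d M p p' (e c)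

  shiftʳ : ∀ p p' → f p' ≤ f p + d M p p'
  shiftʳ p p' = subst (f p' ≤_) (trans (cong (_+ f p) (sym M p' p)) (+-comm (d M p p') (f p)))
    (shiftˡ p' p)

  span : ∀ p p' → d M p p' ≤ f p + f p'
  span p p' = δ≤clamped+clamped (clamped p) (clamped p') (λ c → d≤d+d M p p' (e c))
    (≤-trans (bound M p p') (n≤⌈n/2⌉+⌈n/2⌉ n))

through-core : ∀ {n} (C A B : FinMetric n) {eA : Pt C → Pt A} {eB : Pt C → Pt B} →
  IsIsometry C A eA → IsIsometry C B eB →
  ∀ a b c c' → d A a (eA c) ≤ d B b (eB c) + (d A a (eA c') + d B b (eB c'))
through-core C A B {eA} {eB} eA-iso eB-iso a b c c' = begin
  d A a (eA c)                                     ≤⟨ tri A a (eA c') (eA c) ⟩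
  d A a (eA c') + d A (eA c') (eA c)               ≡⟨ cong (d A a (eA c') +_) C-agrees ⟩
  d A a (eA c') + d B (eB c') (eB c)               ≤⟨ +-monoʳ-≤ _ (tri B (eB c') b (eB c)) ⟩
  d A a (eA c') + (d B (eB c') b + d B b (eB c))   ≡⟨ cong (λ s → d A a (eA c') + (s + d B b (eB c)))
                                                           (sym B (eB c') b) ⟩
  d A a (eA c') + (d B b (eB c') + d B b (eB c))   ≡⟨ +-assoc (d A a (eA c')) _ _ ⟨
  d A a (eA c') + d B b (eB c') + d B b (eB c)     ≡⟨ +-comm _ (d B b (eB c)) ⟩
  d B b (eB c) + (d A a (eA c') + d B b (eB c'))   ∎
  where
  open ≤-Reasoning
  C-agrees : d A (eA c') (eA c) ≡ d B (eB c') (eB c)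
  C-agrees = trans (eA-iso c' c) (≡.sym (eB-iso c' c))

module Amalgamation {n} (C A B : FinMetric n)
  (eA : Pt C → Pt A) (eA-iso : IsIsometry C A eA)
  (eB : Pt C → Pt B) (eB-iso : IsIsometry C B eB) where

  profileA : Pt A → Pt C → ℕ
  profileA a c = d A a (eA c)

  profileB : Pt B → Pt C → ℕ
  profileB b c = d B b (eB c)

  cross : Pt A → Pt B → ℕ
  cross a b = clamp ⌈ n /2⌉ (profileA a) (profileB b)

  cross-clamped : ∀ a b → Clamped ⌈ n /2⌉ (profileA a) (profileB b) (cross a b)
  cross-clamped a b = clamp-clamped _ _ _ λ c c' → m≤n+o∧n≤m+o⇒∣m-n∣≤o
    (through-core C A B {eA} {eB} eA-iso eB-iso a b c c')
    (subst (profileB b c ≤_) (cong (profileA a c +_) (+-comm (profileB b c') (profileA a c')))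
      (through-core C B A eB-iso eA-iso b a c c'))

  cross≤n : ∀ a b → cross a b ≤ n
  cross≤n a b with ≤t⊎diff (cross-clamped a b)
  ... | inj₁ cross≤t         = ≤-trans cross≤t (⌈n/2⌉≤n n)
  ... | inj₂ (c , cross≡diff) = subst (_≤ n) (≡.sym cross≡diff)
    (≤-trans (∣m-n∣≤m⊔n (profileA a c) (profileB b c)) (⊔-lub (bound A _ _) (bound B _ _)))

  cross-core≡0 : ∀ c → cross (eA c) (eB c) ≡ 0
  cross-core≡0 c = n≤0⇒n≡0 (begin
    cross (eA c) (eB c)                       ≤⟨ ≤sum (cross-clamped (eA c) (eB c)) c ⟩
    d A (eA c) (eA c) + d B (eB c) (eB c)     ≡⟨ cong₂ _+_ (proj₂ (zero⇔ A _ _) refl)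
                                                           (proj₂ (zero⇔ B _ _) refl) ⟩
    0                                         ∎)
    where open ≤-Reasoning

  glued : Pt A ⊎ Pt B → Pt A ⊎ Pt B → ℕ
  glued (inj₁ a) (inj₁ a') = d A a a'
  glued (inj₁ a) (inj₂ b)  = cross a b
  glued (inj₂ b) (inj₁ a)  = cross a b
  glued (inj₂ b) (inj₂ b') = d B b b'

  glued≤n : ∀ u v → glued u v ≤ n
  glued≤n (inj₁ a) (inj₁ a') = bound A a a'
  glued≤n (inj₁ a) (inj₂ b)  = cross≤n a b
  glued≤n (inj₂ b) (inj₁ a)  = cross≤n a b
  glued≤n (inj₂ b) (inj₂ b') = bound B b b'

  module ProfilesA b = ClampedProfiles A eA (λ a → cross-clamped a b)
  module ProfilesB a = ClampedProfiles B eB (λ b → clamped-swap (cross-clamped a b))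

  glued-triangle : ∀ u v w → glued u w ≤ glued u v + glued v w
  glued-triangle (inj₁ a) (inj₁ a') (inj₁ a'') = tri A a a' a''
  glued-triangle (inj₁ a) (inj₁ a') (inj₂ b)   = ProfilesA.shiftˡ b a a'
  glued-triangle (inj₁ a) (inj₂ b)  (inj₁ a')  = ProfilesA.span b a a'
  glued-triangle (inj₁ a) (inj₂ b)  (inj₂ b')  = ProfilesB.shiftʳ a b b'
  glued-triangle (inj₂ b) (inj₁ a)  (inj₁ a')  = ProfilesA.shiftʳ b a a'
  glued-triangle (inj₂ b) (inj₁ a)  (inj₂ b')  = ProfilesB.span a b b'
  glued-triangle (inj₂ b) (inj₂ b') (inj₁ a)   = ProfilesB.shiftˡ a b b'
  glued-triangle (inj₂ b) (inj₂ b') (inj₂ b'') = tri B b b' b''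

  glued-isPseudometric : IsPseudometric glued
  glued-isPseudometric = record
    { self≡0    = λ { (inj₁ a) → proj₂ (zero⇔ A a a) refl ; (inj₂ b) → proj₂ (zero⇔ B b b) refl }
    ; symmetric = λ { (inj₁ a) (inj₁ a') → sym A a a' ; (inj₁ a) (inj₂ b) → refl
                    ; (inj₂ b) (inj₁ a) → refl ; (inj₂ b) (inj₂ b') → sym B b b' }
    ; triangle  = glued-triangle
    }

  glued-metric : Σ (FinMetric n) λ D → Σ (Pt A ⊎ Pt B → Pt D) λ ι →
    ∀ u v → d D (ι u) (ι v) ≡ glued u v
  glued-metric = metricIdentification +↔⊎ glued-isPseudometric glued≤n

lemma3p3 : (n : ℕ) → 1 ≤ n →
  (C A B : FinMetric n) →
  (eA : Pt C → Pt A) → IsIsometry C A eA →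
  (eB : Pt C → Pt B) → IsIsometry C B eB →
  Σ (FinMetric n) λ D →
  Σ (Pt A → Pt D) λ ιA → Σ (Pt B → Pt D) λ ιB →
    IsIsometry A D ιA × IsIsometry B D ιB ×
    (∀ c → ιA (eA c) ≡ ιB (eB c)) ×
    (∀ (a : Pt A) (b : Pt B) → (∀ c → eA c ≢ a) → (∀ c → eB c ≢ b) →
      Rule n (d D (ιA a) (ιB b))
        (λ c → d A a (eA c) + d B b (eB c))
        (λ c → ∣ d A a (eA c) - d B b (eB c) ∣))
lemma3p3 n _ C A B eA eA-iso eB eB-iso =
  let (D , ι , ι-isometric) = glued-metric in
  D , ι ∘ inj₁ , ι ∘ inj₂ ,
  (λ a a' → ι-isometric (inj₁ a) (inj₁ a')) ,
  (λ b b' → ι-isometric (inj₂ b) (inj₂ b')) ,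
  (λ c → proj₁ (zero⇔ D _ _) (trans (ι-isometric (inj₁ (eA c)) (inj₂ (eB c))) (cross-core≡0 c))) ,
  λ a b _ _ → subst (λ δ → Rule n δ _ _) (≡.sym (ι-isometric (inj₁ a) (inj₂ b)))
                (clamped⇒rule (cross-clamped a b))
  where open Amalgamation C A B eA eA-iso eB eB-iso
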